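{- Let $m_1,m_2\in\mathbb{Q}$ with $m_1-m_2=P/Q$, $P,Q\in\mathbb{Z}$, $\gcd(P,Q)=1$, and suppose $Q\ge6$. For $n\ge1$ define \[C_n=(144Q)^{ -n}\prod_{k=0}^{n-1}\frac{(12Qk+Q+6P)(12Qk+5Q+6P)}{(Qk+Q+P)(k+1)},\qquad C'_n=(144Q)^{ -n}\prod_{k=0}^{n-1}\frac{(12Qk+Q-6P)(12Qk+5Q-6P)}{(Qk+Q-P)(k+1)}.\] Then one of the following holds: (a) $m_1>m_2$ and for every $n\ge1$ such that $p=Qn+P$ is prime, the $p$-adic valuation of $C_n$ is $-1$; (b) $m_2>m_1$ and for every $n\ge1$ such that $p=Qn-P$ is prime, the $p$-adic valuation of $C'_n$ is $-1$.
   Context: $C_n$ and $C'_n$ equal the hypergeometric coefficients $\frac{(a)_n(1+a-c)_n}{(1+a-b)_n(1)_n}$ and $\frac{(b)_n(1+b-c)_n}{(1+b-a)_n(1)_n}$ with $a=\frac1{12}+\frac{m_1-m_2}2$, $b=\frac1{12}-\frac{m_1-m_2}2$, $c=\frac23$. -}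

module Defs where

open import Data.Bool using (if_then_else_)
open import Data.Nat as ℕ using (ℕ; zero; suc; _≡ᵇ_)
open import Data.Nat.DivMod using (_%_; _/_)
open import Data.Integer as ℤ using (ℤ; +_; +[1+_]; -[1+_]; ∣_∣)
open import Data.Rational as ℚ using (ℚ; mkℚ; 0ℚ; 1ℚ; _÷_; ↥_; ↧ₙ_; _*_)

-- Total division on ℚ with the convention x / 0 = 0 (only ever used with
-- nonzero divisors in the statement).
divℚ : ℚ → ℚ → ℚ
divℚ p (mkℚ (+ zero) d c) = 0ℚ
divℚ p q@(mkℚ +[1+ n ] d c) = p ÷ q
divℚ p q@(mkℚ -[1+ n ] d c) = p ÷ q

prodℚ : ℕ → (ℕ → ℚ) → ℚ
prodℚ zero f = 1ℚ
prodℚ (suc n) f = prodℚ n f * f n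

-- p-adic valuation of a natural number m (for p ≥ 2, m ≥ 1): the number of
-- times p divides m.  Computed with fuel m, which suffices since p ≥ 2.
-- Junk value for m = 0 and p < 2 is 0.
private
  vgo : ℕ → (p : ℕ) → .{{ℕ.NonZero p}} → ℕ → ℕ
  vgo zero p m = 0
  vgo (suc f) p m =
    if m ≡ᵇ 0 then 0 else (if m % p ≡ᵇ 0 then suc (vgo f p (m / p)) else 0)

vℕ : ℕ → ℕ → ℕ
vℕ zero m = 0
vℕ (suc zero) m = 0
vℕ (suc (suc k)) m = vgo m (suc (suc k)) m

-- p-adic valuation of a rational number (in lowest terms n/d):
-- v_p(n/d) = v_p(|n|) - v_p(d).  (Junk value 0 at 0.)
vℚ : ℕ → ℚ → ℤ
vℚ p q = (+ vℕ p ∣ ↥ q ∣) ℤ.- (+ vℕ p (↧ₙ q))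

Cseq : ℤ → ℤ → ℕ → ℚ
Cseq P Q n =
  divℚ (prodℚ n (λ k →
          divℚ (ℚ._/_ ((+ 12 ℤ.* Q ℤ.* + k ℤ.+ Q ℤ.+ + 6 ℤ.* P)
                       ℤ.* (+ 12 ℤ.* Q ℤ.* + k ℤ.+ + 5 ℤ.* Q ℤ.+ + 6 ℤ.* P)) 1)
               (ℚ._/_ ((Q ℤ.* + k ℤ.+ Q ℤ.+ P) ℤ.* + (suc k)) 1)))
       (ℚ._/_ ((+ 144 ℤ.* Q) ℤ.^ n) 1)

C'seq : ℤ → ℤ → ℕ → ℚ
C'seq P Q n =
  divℚ (prodℚ n (λ k →
          divℚ (ℚ._/_ ((+ 12 ℤ.* Q ℤ.* + k ℤ.+ Q ℤ.- + 6 ℤ.* P)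
                       ℤ.* (+ 12 ℤ.* Q ℤ.* + k ℤ.+ + 5 ℤ.* Q ℤ.- + 6 ℤ.* P)) 1)
               (ℚ._/_ ((Q ℤ.* + k ℤ.+ Q ℤ.- P) ℤ.* + (suc k)) 1)))
       (ℚ._/_ ((+ 144 ℤ.* Q) ℤ.^ n) 1)

module Submission where

-- Write P, Q > 0 for the natural numbers involved (the case P < 0 is the same
-- computation for C'_N with |P| in place of P), N = n + 1, and p = QN + P prime.
-- By definition C_N = ∏_{j<N} A_j B_j / (D_j (j+1)) divided by (144Q)^N, where
--   A_j = 12Qj + Q + 6P,   B_j = 12Qj + 5Q + 6P,   D_j = Q(j+1) + P.
-- Every factor is prime to p except D_n = p itself:
--   * 0 < D_j < p for j < n, and j + 1 ≤ N < p;
--   * p ∤ Q because gcd(P, Q) = 1, and p > 6 since Q ≥ 6, so p ∤ 144Q;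
--   * A_j, B_j differ from 6p by ±Q·d with 0 < d < p (d = |12j - 6N + 1|,
--     resp. |12j - 6N + 5|), so they are prime to p.
-- Hence v_p(C_N) = -1.  The development: valuations of naturals (NatValuation);
-- rationals with v_p = 0 ("units") and v_p = -1 ("poles") and their closure
-- under the operations building a hypergeometric coefficient (PAdic, ending in
-- vℚ-hyperCoeff); the arithmetic facts above (Arithmetic); the bridge from the
-- integer expressions of Defs (IntegerForms, Coefficients); the sign of
-- m₁ - m₂ = P/Q (Sign); and finally the theorem, by cases on the sign of P.

open import Defs
open import Data.Nat as ℕ using (ℕ)
open import Data.Nat.Primality using (Prime)
import Data.Nat.GCD
open import Relation.Binary.PropositionalEquality using (_≡_)

module NatValuation where

  open import Data.Nat using (zero; suc; _*_; _%_; _/_; _<_; s≤s)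
  open import Data.Nat.DivMod using (m*n%n≡0; m*n/n≡m)
  open import Data.Nat.Divisibility using (_∤_; _∣0; m%n≡0⇒n∣m)
  open import Data.Empty using (⊥-elim)
  open import Relation.Binary.PropositionalEquality using (_≡_; refl; trans; cong)

  vℕ-coprime : ∀ p m → 1 < p → p ∤ m → vℕ p m ≡ 0
  vℕ-coprime (suc zero) _ (s≤s ()) _
  vℕ-coprime (suc (suc k)) zero _ p∤m = ⊥-elim (p∤m (_ ∣0))
  vℕ-coprime p@(suc (suc k)) (suc m) _ p∤m with suc m % p in r
  ... | zero  = ⊥-elim (p∤m (m%n≡0⇒n∣m (suc m) p r))
  ... | suc _ = refl

  -- v_p(m·p) = 1 when p ∤ m: one division by p, after which the remainder is nonzero.
  vℕ-exact : ∀ p m → 1 < p → p ∤ m → vℕ p (m * p) ≡ 1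
  vℕ-exact (suc zero) _ (s≤s ()) _
  vℕ-exact (suc (suc k)) zero _ p∤m = ⊥-elim (p∤m (_ ∣0))
  vℕ-exact p@(suc (suc k)) m@(suc _) _ p∤m = go (m * p) refl
    where
    go : ∀ x → x ≡ m * p → vℕ p x ≡ 1
    go (suc f) e rewrite trans (cong (_% p) e) (m*n%n≡0 m p)
                       | trans (cong (_/ p) e) (m*n/n≡m m p) with f
    ... | zero = refl
    ... | suc _ with m % p in r
    ...   | zero  = ⊥-elim (p∤m (m%n≡0⇒n∣m m p r))
    ...   | suc _ = refl

module IntegerFractions where

  open import Data.Nat as ℕ using (zero; suc)
  open import Data.Nat.GCD using (gcd-zeroʳ)
  open import Data.Integer as ℤ using (+_; ∣_∣)
  import Data.Integer.Properties as ℤP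
  open import Data.Rational as ℚ using (↥_; ↧_; ↧ₙ_)
  import Data.Rational.Properties as ℚP
  open import Relation.Binary.PropositionalEquality using (_≡_; refl; trans; sym; cong)

  ↥-/1 : ∀ i → ↥ (i ℚ./ 1) ≡ i
  ↥-/1 i = trans (sym (ℤP.*-identityʳ _))
                 (trans (cong (λ g → ↥ (i ℚ./ 1) ℤ.* + g) (sym (gcd-zeroʳ ∣ i ∣))) (ℚP.↥-/ i 1))

  ↧ₙ-/1 : ∀ i → ↧ₙ (i ℚ./ 1) ≡ 1
  ↧ₙ-/1 i = ℤP.+-injective
    (trans (sym (ℤP.*-identityʳ _))
           (trans (cong (λ g → ↧ (i ℚ./ 1) ℤ.* + g) (sym (gcd-zeroʳ ∣ i ∣))) (ℚP.↧-/ i 1)))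

  ∣^∣ : ∀ i m → ∣ i ℤ.^ m ∣ ≡ ∣ i ∣ ℕ.^ m
  ∣^∣ i zero = refl
  ∣^∣ i (suc m) = trans (ℤP.abs-* i (i ℤ.^ m)) (cong (∣ i ∣ ℕ.*_) (∣^∣ i m))

module Hypergeometric where

  open import Data.Nat using (ℕ; suc)
  open import Data.Integer as ℤ using (ℤ; +_)
  open import Data.Rational as ℚ using (ℚ)

  hyperTerm : (A B D : ℕ → ℤ) → ℕ → ℚ
  hyperTerm A B D j = divℚ ((A j ℤ.* B j) ℚ./ 1) ((D j ℤ.* + suc j) ℚ./ 1)

  hyperCoeff : (A B D : ℕ → ℤ) → ℤ → ℕ → ℚ
  hyperCoeff A B D E n = divℚ (prodℚ n (hyperTerm A B D)) ((E ℤ.^ n) ℚ./ 1)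

module PAdic (p : ℕ) (p-prime : Prime p) where

  open NatValuation
  open IntegerFractions
  open Hypergeometric
  open import Data.Nat as ℕ using (ℕ; zero; suc; _*_; _^_; _<_; _≤_)
  import Data.Nat.Properties as ℕP
  open import Data.Nat.Tactic.RingSolver using (solve-∀)
  open import Data.Nat.Divisibility using (_∣_; _∤_; divides; _∣0; ∣-trans; m∣m*n; n∣m*n; ∣1⇒≡1; >⇒∤)
  open import Data.Nat.Primality using (euclidsLemma; prime⇒nonTrivial; prime⇒nonZero)
  open import Data.Integer as ℤ using (ℤ; +_; -[1+_]; +[1+_]; ∣_∣)
  import Data.Integer.Properties as ℤP
  open import Data.Integer.GCD using (gcd)
  open import Data.Rational as ℚ using (ℚ; mkℚ; ↥_; ↧ₙ_)
  import Data.Rational.Properties as ℚP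
  open import Data.Product using (Σ; _×_; _,_)
  open import Data.Sum using ([_,_]; inj₁; inj₂)
  open import Data.Empty using (⊥-elim)
  open import Relation.Binary.PropositionalEquality
    using (_≡_; _≢_; refl; sym; trans; cong; subst; module ≡-Reasoning)

  private instance
    p≢0 : ℕ.NonZero p
    p≢0 = prime⇒nonZero p-prime

  1<p : 1 < p
  1<p = ℕ.nonTrivial⇒n>1 p {{prime⇒nonTrivial p-prime}}

  p∤1 : p ∤ 1
  p∤1 p∣1 = ℕP.<⇒≢ 1<p (sym (∣1⇒≡1 p∣1))

  ∤⇒≢0 : ∀ {m} → p ∤ m → m ≢ 0
  ∤⇒≢0 p∤m refl = p∤m (p ∣0)

  ∤-* : ∀ {a b} → p ∤ a → p ∤ b → p ∤ a * b
  ∤-* {a} {b} p∤a p∤b p∣ab = [ p∤a , p∤b ] (euclidsLemma a b p-prime p∣ab)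

  ∤-^ : ∀ {a} m → p ∤ a → p ∤ a ^ m
  ∤-^ zero    _   = p∤1
  ∤-^ (suc m) p∤a = ∤-* p∤a (∤-^ m p∤a)

  ∤-factorˡ : ∀ {a b c} → a * b ≡ c → p ∤ c → p ∤ a
  ∤-factorˡ {a} {b} refl p∤c p∣a = p∤c (∣-trans p∣a (m∣m*n b))

  ∤-factorʳ : ∀ {a b c} → a * b ≡ c → p ∤ c → p ∤ b
  ∤-factorʳ {a} {b} refl p∤c p∣b = p∤c (∣-trans p∣b (n∣m*n a))

  *-right-comm : ∀ a b c → a * b * c ≡ a * c * b
  *-right-comm = solve-∀

  Exact : ℕ → Set
  Exact c = Σ ℕ λ m → c ≡ m * p × p ∤ m

  exact⇒≢0 : ∀ {c} → Exact c → c ≢ 0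
  exact⇒≢0 (m , c≡mp , p∤m) c≡0 = ∤⇒≢0 p∤m (ℕP.m*n≡0⇒m≡0 m p (trans (sym c≡mp) c≡0))

  exact-* : ∀ {a b} → p ∤ a → Exact b → Exact (a * b)
  exact-* {a} {b} p∤a (m , refl , p∤m) = a * m , sym (ℕP.*-assoc a m p) , ∤-* p∤a p∤m

  exact-cancel : ∀ {a g c} → a * g ≡ c → Exact c → p ∤ g → Exact a
  exact-cancel {a} {g} a*g≡c (m , c≡mp , p∤m) p∤g
    with euclidsLemma a g p-prime (divides m (trans a*g≡c c≡mp))
  ... | inj₂ p∣g = ⊥-elim (p∤g p∣g)
  ... | inj₁ (divides a′ a≡a′p) = a′ , a≡a′p , p∤a′
    where
    a′g≡m : a′ * g ≡ m
    a′g≡m = ℕP.*-cancelʳ-≡ (a′ * g) m p (begin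
      a′ * g * p ≡⟨ *-right-comm a′ g p ⟩
      a′ * p * g ≡⟨ cong (_* g) (sym a≡a′p) ⟩
      a * g      ≡⟨ trans a*g≡c c≡mp ⟩
      m * p      ∎)
      where open ≡-Reasoning
    p∤a′ : p ∤ a′
    p∤a′ p∣a′ = p∤m (subst (p ∣_) a′g≡m (∣-trans p∣a′ (m∣m*n g)))

  Unit : ℚ → Set
  Unit x = p ∤ ∣ ↥ x ∣ × p ∤ ↧ₙ x

  Pole : ℚ → Set
  Pole x = p ∤ ∣ ↥ x ∣ × Exact (↧ₙ x)

  common : ℚ → ℚ → ℤ
  common x y = gcd (↥ x ℤ.* ↥ y) (ℚ.↧ x ℤ.* ℚ.↧ y)

  cancelled : ℚ → ℚ → ℕ
  cancelled x y = ∣ common x y ∣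

  ↥-* : ∀ x y → ∣ ↥ (x ℚ.* y) ∣ * cancelled x y ≡ ∣ ↥ x ∣ * ∣ ↥ y ∣
  ↥-* x y = trans (sym (ℤP.abs-* (↥ (x ℚ.* y)) (common x y)))
                  (trans (cong ∣_∣ (ℚP.↥-* x y)) (ℤP.abs-* (↥ x) (↥ y)))

  ↧ₙ-* : ∀ x y → ↧ₙ (x ℚ.* y) * cancelled x y ≡ ↧ₙ x * ↧ₙ y
  ↧ₙ-* x y = trans (sym (ℤP.abs-* (ℚ.↧ (x ℚ.* y)) (common x y)))
                   (trans (cong ∣_∣ (ℚP.↧-* x y)) (ℤP.abs-* (ℚ.↧ x) (ℚ.↧ y)))

  unit-* : ∀ x y → Unit x → Unit y → Unit (x ℚ.* y)
  unit-* x y (p∤n₁ , p∤d₁) (p∤n₂ , p∤d₂) =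
    ∤-factorˡ (↥-* x y) (∤-* p∤n₁ p∤n₂) , ∤-factorˡ (↧ₙ-* x y) (∤-* p∤d₁ p∤d₂)

  -- Cancellation cannot remove the factor p from the denominator, since the
  -- cancelled factor divides the numerator, which is prime to p.
  pole-* : ∀ x y → Unit x → Pole y → Pole (x ℚ.* y)
  pole-* x y (p∤n₁ , p∤d₁) (p∤n₂ , exact-d₂) =
    ∤-factorˡ (↥-* x y) p∤n₁n₂ ,
    exact-cancel (↧ₙ-* x y) (exact-* p∤d₁ exact-d₂) p∤cancelled
    where
    p∤n₁n₂ : p ∤ ∣ ↥ x ∣ * ∣ ↥ y ∣
    p∤n₁n₂ = ∤-* p∤n₁ p∤n₂
    p∤cancelled : p ∤ cancelled x y
    p∤cancelled = ∤-factorʳ {∣ ↥ (x ℚ.* y) ∣} (↥-* x y) p∤n₁n₂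

  divℚ-swap : ∀ x q → ∣ ↥ q ∣ ≢ 0 →
              Σ ℚ λ r → divℚ x q ≡ x ℚ.* r × ∣ ↥ r ∣ ≡ ↧ₙ q × ↧ₙ r ≡ ∣ ↥ q ∣
  divℚ-swap x (mkℚ (+ zero)  _ _) q≢0 = ⊥-elim (q≢0 refl)
  divℚ-swap x (mkℚ +[1+ _ ] _ _) _   = _ , refl , refl , refl
  divℚ-swap x (mkℚ -[1+ _ ] _ _) _   = _ , refl , refl , refl

  unit-÷ : ∀ x q → Unit x → Unit q → Unit (divℚ x q)
  unit-÷ x q ux (p∤n , p∤d) with divℚ-swap x q (∤⇒≢0 p∤n)
  ... | r , ÷≡* , ∣↥r∣≡ , ↧r≡ rewrite ÷≡* =
    unit-* x r ux (subst (p ∤_) (sym ∣↥r∣≡) p∤d , subst (p ∤_) (sym ↧r≡) p∤n)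

  pole-÷ : ∀ x q → Pole x → Unit q → Pole (divℚ x q)
  pole-÷ x q px (p∤n , p∤d) with divℚ-swap x q (∤⇒≢0 p∤n)
  ... | r , ÷≡* , ∣↥r∣≡ , ↧r≡ rewrite ÷≡* =
    subst Pole (ℚP.*-comm r x)
      (pole-* r x (subst (p ∤_) (sym ∣↥r∣≡) p∤d , subst (p ∤_) (sym ↧r≡) p∤n) px)

  unit-÷-exact : ∀ x q → Unit x → Exact ∣ ↥ q ∣ → p ∤ ↧ₙ q → Pole (divℚ x q)
  unit-÷-exact x q ux exact-n p∤d with divℚ-swap x q (exact⇒≢0 exact-n)
  ... | r , ÷≡* , ∣↥r∣≡ , ↧r≡ rewrite ÷≡* =
    pole-* x r ux (subst (p ∤_) (sym ∣↥r∣≡) p∤d , subst Exact (sym ↧r≡) exact-n)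

  unit-/1 : ∀ i → p ∤ ∣ i ∣ → Unit (i ℚ./ 1)
  unit-/1 i p∤i = subst (λ j → p ∤ ∣ j ∣) (sym (↥-/1 i)) p∤i , subst (p ∤_) (sym (↧ₙ-/1 i)) p∤1

  unit-prodℚ : ∀ n f → (∀ j → j < n → Unit (f j)) → Unit (prodℚ n f)
  unit-prodℚ zero    f _ = p∤1 , p∤1
  unit-prodℚ (suc n) f u =
    unit-* (prodℚ n f) (f n) (unit-prodℚ n f (λ j j<n → u j (ℕP.m<n⇒m<1+n j<n))) (u n ℕP.≤-refl)

  vℚ-pole : ∀ x → Pole x → vℚ p x ≡ -[1+ 0 ]
  vℚ-pole x (p∤n , m , d≡mp , p∤m)
    rewrite vℕ-coprime p ∣ ↥ x ∣ 1<p p∤n | d≡mp | vℕ-exact p m 1<p p∤m = refl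

  vℚ-hyperCoeff : (A B D : ℕ → ℤ) (E : ℤ) (n : ℕ) →
    (∀ j → j ≤ n → p ∤ ∣ A j ∣) → (∀ j → j ≤ n → p ∤ ∣ B j ∣) →
    (∀ j → j < n → p ∤ ∣ D j ∣) → ∣ D n ∣ ≡ p → suc n < p → p ∤ ∣ E ∣ →
    vℚ p (hyperCoeff A B D E (suc n)) ≡ -[1+ 0 ]
  vℚ-hyperCoeff A B D E n p∤A p∤B p∤D ∣Dₙ∣≡p n<p p∤E =
    vℚ-pole (hyperCoeff A B D E (suc n))
      (pole-÷ (prodℚ (suc n) term) ((E ℤ.^ suc n) ℚ./ 1) product-pole power-unit)
    where
    term : ℕ → ℚ
    term = hyperTerm A B D
    p∤suc : ∀ j → j ≤ n → p ∤ suc j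
    p∤suc j j≤n = >⇒∤ (ℕP.≤-<-trans (ℕ.s≤s j≤n) n<p)
    p∤num : ∀ j → j ≤ n → p ∤ ∣ A j ℤ.* B j ∣
    p∤num j j≤n = subst (p ∤_) (sym (ℤP.abs-* (A j) (B j))) (∤-* (p∤A j j≤n) (p∤B j j≤n))
    unit-term : ∀ j → j < n → Unit (term j)
    unit-term j j<n =
      unit-÷ ((A j ℤ.* B j) ℚ./ 1) ((D j ℤ.* + suc j) ℚ./ 1)
        (unit-/1 (A j ℤ.* B j) (p∤num j (ℕP.<⇒≤ j<n)))
        (unit-/1 (D j ℤ.* + suc j) (subst (p ∤_) (sym (ℤP.abs-* (D j) (+ suc j)))
                                          (∤-* (p∤D j j<n) (p∤suc j (ℕP.<⇒≤ j<n)))))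
    ∣Dₙ·N∣≡N·p : ∣ ↥ ((D n ℤ.* + suc n) ℚ./ 1) ∣ ≡ suc n * p
    ∣Dₙ·N∣≡N·p = begin
      ∣ ↥ ((D n ℤ.* + suc n) ℚ./ 1) ∣ ≡⟨ cong ∣_∣ (↥-/1 (D n ℤ.* + suc n)) ⟩
      ∣ D n ℤ.* + suc n ∣             ≡⟨ ℤP.abs-* (D n) (+ suc n) ⟩
      ∣ D n ∣ * suc n                 ≡⟨ cong (_* suc n) ∣Dₙ∣≡p ⟩
      p * suc n                       ≡⟨ ℕP.*-comm p (suc n) ⟩
      suc n * p                       ∎
      where open ≡-Reasoning
    last-pole : Pole (term n)
    last-pole =
      unit-÷-exact ((A n ℤ.* B n) ℚ./ 1) ((D n ℤ.* + suc n) ℚ./ 1)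
        (unit-/1 (A n ℤ.* B n) (p∤num n ℕP.≤-refl))
        (suc n , ∣Dₙ·N∣≡N·p , p∤suc n ℕP.≤-refl)
        (subst (p ∤_) (sym (↧ₙ-/1 (D n ℤ.* + suc n))) p∤1)
    product-pole : Pole (prodℚ (suc n) term)
    product-pole = pole-* (prodℚ n term) (term n)
                          (unit-prodℚ n term unit-term) last-pole
    power-unit : Unit ((E ℤ.^ suc n) ℚ./ 1)
    power-unit = unit-/1 (E ℤ.^ suc n) (subst (p ∤_) (sym (∣^∣ E (suc n))) (∤-^ (suc n) p∤E))

module Arithmetic (P Q n p : ℕ) (p-prime : Prime p) (6≤Q : 6 ℕ.≤ Q) (0<P : 0 ℕ.< P)
                  (coprime : Data.Nat.GCD.gcd P Q ≡ 1) (p≡QN+P : p ≡ Q ℕ.* ℕ.suc n ℕ.+ P) where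

  open PAdic p p-prime using (p∤1; ∤-*; ∤-^; vℚ-hyperCoeff)
  open Hypergeometric using (hyperCoeff)
  open import Data.Nat using (suc; _+_; _*_; _∸_; _≤_; _<_; _≤?_; z≤n; s≤s; >-nonZero)
  open import Data.Nat.Properties
  open import Data.Nat.Tactic.RingSolver using (solve-∀)
  open import Data.Nat.Divisibility using (_∣_; _∤_; ∣-refl; ∣-trans; m∣m*n; n∣m*n; ∣m+n∣m⇒∣n; >⇒∤)
  open import Data.Nat.GCD using (gcd-greatest)
  open import Data.Nat.Primality using (euclidsLemma)
  open import Data.Integer as ℤ using (ℤ; -[1+_]; ∣_∣)
  import Data.Integer.Properties as ℤP
  open import Data.Sum using (_⊎_; inj₁; inj₂; [_,_])
  open import Relation.Nullary using (yes; no)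
  open import Relation.Binary.PropositionalEquality
    using (_≡_; refl; sym; trans; cong; subst; module ≡-Reasoning)

  N : ℕ
  N = suc n

  -- p ∤ Q: otherwise p divides P = p - QN as well, hence gcd(P, Q) = 1.
  p∤Q : p ∤ Q
  p∤Q p∣Q = p∤1 (subst (p ∣_) coprime (gcd-greatest p∣P p∣Q))
    where
    p∣P : p ∣ P
    p∣P = ∣m+n∣m⇒∣n (subst (p ∣_) p≡QN+P ∣-refl) (∣-trans p∣Q (m∣m*n N))

  6N<p : 6 * N < p
  6N<p = begin-strict
    6 * N     ≤⟨ *-monoˡ-≤ N 6≤Q ⟩
    Q * N     <⟨ m<m+n (Q * N) 0<P ⟩
    Q * N + P ≡⟨ sym p≡QN+P ⟩
    p         ∎
    where open ≤-Reasoning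

  -- In particular p exceeds N and 6, so p ∤ j + 1 for j < N and p ∤ 144 = 2⁴·3².
  N<p : N < p
  N<p = ≤-<-trans (m≤n*m N 6) 6N<p

  6<p : 6 < p
  6<p = ≤-<-trans (m≤m*n 6 N) 6N<p

  p∤144Q : p ∤ 144 * Q
  p∤144Q = ∤-* (∤-* (∤-^ 4 p∤2) (∤-^ 2 p∤3)) p∤Q
    where
    p∤2 : p ∤ 2
    p∤2 = >⇒∤ (<-trans (s≤s (s≤s (s≤s z≤n))) 6<p)
    p∤3 : p ∤ 3
    p∤3 = >⇒∤ (<-trans (s≤s (s≤s (s≤s (s≤s z≤n)))) 6<p)

  p∤Q*d : ∀ d → 0 < d → d < p → p ∤ Q * d
  p∤Q*d d 0<d d<p p∣Qd =
    [ p∤Q , >⇒∤ {{>-nonZero 0<d}} d<p ] (euclidsLemma Q d p-prime p∣Qd)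

  p∤6p±Q*d : ∀ a d → 0 < d → d < p → a ≡ 6 * p + Q * d ⊎ a + Q * d ≡ 6 * p → p ∤ a
  p∤6p±Q*d a d 0<d d<p (inj₁ a≡) p∣a =
    p∤Q*d d 0<d d<p (∣m+n∣m⇒∣n (subst (p ∣_) a≡ p∣a) (n∣m*n 6))
  p∤6p±Q*d a d 0<d d<p (inj₂ a+Qd≡) p∣a =
    p∤Q*d d 0<d d<p (∣m+n∣m⇒∣n (subst (p ∣_) (sym a+Qd≡) (n∣m*n 6)) p∣a)

  6t+c<p : ∀ t c → t < N → c < 6 → 6 * t + c < p
  6t+c<p t c t<N c<6 = begin-strict
    6 * t + c     <⟨ +-monoʳ-< (6 * t) c<6 ⟩
    6 * t + 6     ≡⟨ trans (+-comm (6 * t) 6) (sym (*-suc 6 t)) ⟩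
    6 * suc t     ≤⟨ *-monoʳ-≤ 6 t<N ⟩
    6 * N         <⟨ 6N<p ⟩
    p             ∎
    where open ≤-Reasoning

  double : ∀ q r j c → 2 * (12 * q * j + c * q + 6 * r) ≡ 12 * q * (2 * j) + 2 * c * q + 12 * r
  double = solve-∀

  regroup : ∀ q r m t c →
            12 * q * (m + t) + 2 * c * q + 12 * r ≡ 2 * (6 * (q * m + r) + q * (6 * t + c))
  regroup = solve-∀

  split : ∀ q r j t c c′ →
          12 * q * j + c * q + 6 * r + q * (6 * t + c′) ≡ 6 * (q * (2 * j + t) + r) + q * (c + c′)
  split = solve-∀

  absorb : ∀ q r j t → 6 * (q * (2 * j + t) + r) + q * 6 ≡ 6 * (q * (suc (2 * j) + t) + r)
  absorb = solve-∀

  numerator-above : ∀ c j t → 2 * j ≡ N + t → 12 * Q * j + c * Q + 6 * P ≡ 6 * p + Q * (6 * t + c)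
  numerator-above c j t 2j≡N+t = *-cancelˡ-≡ _ _ 2 (begin
    2 * (12 * Q * j + c * Q + 6 * P)       ≡⟨ double Q P j c ⟩
    12 * Q * (2 * j) + 2 * c * Q + 12 * P   ≡⟨ cong (λ x → 12 * Q * x + 2 * c * Q + 12 * P) 2j≡N+t ⟩
    12 * Q * (N + t) + 2 * c * Q + 12 * P   ≡⟨ regroup Q P N t c ⟩
    2 * (6 * (Q * N + P) + Q * (6 * t + c)) ≡⟨ cong (λ x → 2 * (6 * x + Q * (6 * t + c))) (sym p≡QN+P) ⟩
    2 * (6 * p + Q * (6 * t + c))           ∎)
    where open ≡-Reasoning

  numerator-below : ∀ c c′ j t → c + c′ ≡ 6 → N ≡ suc (2 * j) + t →
                    12 * Q * j + c * Q + 6 * P + Q * (6 * t + c′) ≡ 6 * p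
  numerator-below c c′ j t c+c′≡6 N≡2j+1+t = begin
    12 * Q * j + c * Q + 6 * P + Q * (6 * t + c′) ≡⟨ split Q P j t c c′ ⟩
    6 * (Q * (2 * j + t) + P) + Q * (c + c′)      ≡⟨ cong (λ x → 6 * (Q * (2 * j + t) + P) + Q * x) c+c′≡6 ⟩
    6 * (Q * (2 * j + t) + P) + Q * 6             ≡⟨ absorb Q P j t ⟩
    6 * (Q * (suc (2 * j) + t) + P)               ≡⟨ cong (λ x → 6 * (Q * x + P)) (sym N≡2j+1+t) ⟩
    6 * (Q * N + P)                               ≡⟨ cong (6 *_) (sym p≡QN+P) ⟩
    6 * p                                         ∎
    where open ≡-Reasoning

  -- For j < N and c + c′ = 6 with c, c′ > 0, the number 12Qj + cQ + 6P is prime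
  -- to p: it is 6p + Q(6t + c) or 6p - Q(6t + c′) with t < N, and 6t + c,
  -- 6t + c′ lie strictly between 0 and p.
  p∤numerator : ∀ c c′ j → c + c′ ≡ 6 → 0 < c → 0 < c′ → j < N →
                p ∤ 12 * Q * j + c * Q + 6 * P
  p∤numerator c c′ j c+c′≡6 0<c 0<c′ j<N with N ≤? 2 * j
  ... | yes N≤2j =
    p∤6p±Q*d _ (6 * t + c) (≤-trans 0<c (m≤n+m c (6 * t))) (6t+c<p t c t<N c<6)
             (inj₁ (numerator-above c j t 2j≡N+t))
    where
    t : ℕ
    t = 2 * j ∸ N
    2j≡N+t : 2 * j ≡ N + t
    2j≡N+t = sym (m+[n∸m]≡n N≤2j)
    t<N : t < N
    t<N = +-cancelˡ-< N t N (begin-strict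
      N + t ≡⟨ sym 2j≡N+t ⟩
      2 * j ≡⟨ cong (j +_) (+-identityʳ j) ⟩
      j + j <⟨ +-mono-< j<N j<N ⟩
      N + N ∎)
      where open ≤-Reasoning
    c<6 : c < 6
    c<6 = subst (c <_) c+c′≡6 (m<m+n c 0<c′)
  ... | no N≰2j =
    p∤6p±Q*d _ (6 * t + c′) (≤-trans 0<c′ (m≤n+m c′ (6 * t))) (6t+c<p t c′ t<N c′<6)
             (inj₂ (numerator-below c c′ j t c+c′≡6 N≡2j+1+t))
    where
    t : ℕ
    t = N ∸ suc (2 * j)
    N≡2j+1+t : N ≡ suc (2 * j) + t
    N≡2j+1+t = sym (m+[n∸m]≡n (≰⇒> N≰2j))
    t<N : t < N
    t<N = subst (t <_) (sym N≡2j+1+t) (m<n+m t (s≤s z≤n))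
    c′<6 : c′ < 6
    c′<6 = subst (c′ <_) (trans (+-comm c′ c) c+c′≡6) (m<m+n c′ 0<c)

  p∤A : ∀ j → j < N → p ∤ 12 * Q * j + Q + 6 * P
  p∤A j j<N = subst (λ x → p ∤ 12 * Q * j + x + 6 * P) (*-identityˡ Q)
                    (p∤numerator 1 5 j refl (s≤s z≤n) (s≤s z≤n) j<N)

  p∤B : ∀ j → j < N → p ∤ 12 * Q * j + 5 * Q + 6 * P
  p∤B j j<N = p∤numerator 5 1 j refl (s≤s z≤n) (s≤s z≤n) j<N

  Qj+Q≡Q[1+j] : ∀ j → Q * j + Q ≡ Q * suc j
  Qj+Q≡Q[1+j] j = trans (+-comm (Q * j) Q) (sym (*-suc Q j))

  p∤D : ∀ j → j < n → p ∤ Q * j + Q + P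
  p∤D j j<n = >⇒∤ {{>-nonZero (≤-trans 0<P (m≤n+m P (Q * j + Q)))}} (begin-strict
    Q * j + Q + P   ≡⟨ cong (_+ P) (Qj+Q≡Q[1+j] j) ⟩
    Q * suc j + P   <⟨ +-monoˡ-< P (*-monoʳ-< Q {{>-nonZero (<-≤-trans (s≤s z≤n) 6≤Q)}} (s≤s j<n)) ⟩
    Q * N + P       ≡⟨ sym p≡QN+P ⟩
    p               ∎)
    where open ≤-Reasoning

  D-last : Q * n + Q + P ≡ p
  D-last = trans (cong (_+ P) (Qj+Q≡Q[1+j] n)) (sym p≡QN+P)

  vℚ-coefficient : (A B D : ℕ → ℤ) →
    (∀ j → ∣ A j ∣ ≡ 12 * Q * j + Q + 6 * P) →
    (∀ j → ∣ B j ∣ ≡ 12 * Q * j + 5 * Q + 6 * P) →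
    (∀ j → ∣ D j ∣ ≡ Q * j + Q + P) →
    vℚ p (hyperCoeff A B D (ℤ.+ 144 ℤ.* ℤ.+ Q) N) ≡ -[1+ 0 ]
  vℚ-coefficient A B D ∣A∣ ∣B∣ ∣D∣ =
    vℚ-hyperCoeff A B D (ℤ.+ 144 ℤ.* ℤ.+ Q) n
      (λ j j≤n → subst (p ∤_) (sym (∣A∣ j)) (p∤A j (s≤s j≤n)))
      (λ j j≤n → subst (p ∤_) (sym (∣B∣ j)) (p∤B j (s≤s j≤n)))
      (λ j j<n → subst (p ∤_) (sym (∣D∣ j)) (p∤D j j<n))
      (trans (∣D∣ n) D-last)
      N<p
      (subst (p ∤_) (sym (ℤP.abs-* (ℤ.+ 144) (ℤ.+ Q))) p∤144Q)

module IntegerForms where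

  open import Data.Nat using (_+_; _*_)
  open import Data.Integer as ℤ using (+_; ∣_∣)
  open import Data.Integer.Properties using (pos-+; pos-*; +-injective)
  open import Data.Integer.Tactic.RingSolver using (solve-∀)
  open import Relation.Binary.PropositionalEquality using (_≡_; refl; sym)

  -- +_ commutes with + and *, so the absolute value of each factor is the same
  -- expression evaluated in ℕ.
  ∣A∣ : ∀ Q P j → ∣ + 12 ℤ.* + Q ℤ.* + j ℤ.+ + Q ℤ.+ + 6 ℤ.* + P ∣ ≡ 12 * Q * j + Q + 6 * P
  ∣A∣ Q P j rewrite sym (pos-* 12 Q) | sym (pos-* (12 * Q) j) | sym (pos-* 6 P)
                  | sym (pos-+ (12 * Q * j) Q) | sym (pos-+ (12 * Q * j + Q) (6 * P)) = refl

  ∣B∣ : ∀ Q P j → ∣ + 12 ℤ.* + Q ℤ.* + j ℤ.+ + 5 ℤ.* + Q ℤ.+ + 6 ℤ.* + P ∣ ≡ 12 * Q * j + 5 * Q + 6 * P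
  ∣B∣ Q P j rewrite sym (pos-* 12 Q) | sym (pos-* (12 * Q) j) | sym (pos-* 5 Q) | sym (pos-* 6 P)
                  | sym (pos-+ (12 * Q * j) (5 * Q)) | sym (pos-+ (12 * Q * j + 5 * Q) (6 * P)) = refl

  ∣D∣ : ∀ Q P j → ∣ + Q ℤ.* + j ℤ.+ + Q ℤ.+ + P ∣ ≡ Q * j + Q + P
  ∣D∣ Q P j rewrite sym (pos-* Q j) | sym (pos-+ (Q * j) Q) | sym (pos-+ (Q * j + Q) P) = refl

  -- Subtracting 6·(-k) is adding 6k: the factors of C'_N for -P are those of C_N for P.
  sub-6*neg : ∀ x k → x ℤ.- + 6 ℤ.* (ℤ.- k) ≡ x ℤ.+ + 6 ℤ.* k
  sub-6*neg = solve-∀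

  +-linear : ∀ p Q N P → + p ≡ + Q ℤ.* + N ℤ.+ + P → p ≡ Q * N + P
  +-linear p Q N P p≡ rewrite sym (pos-* Q N) | sym (pos-+ (Q * N) P) = +-injective p≡

module Sign where

  open import Data.Nat as ℕ using (suc)
  open import Data.Integer using (+_; +[1+_]; -[1+_])
  open import Data.Rational as ℚ using (mkℚ; _-_; _<_; 0ℚ; Positive; Negative)
  import Data.Rational.Properties as ℚP
  open import Relation.Binary.PropositionalEquality
    using (_≡_; sym; cong; subst₂; module ≡-Reasoning)

  divℚ-pos : ∀ x q → Positive x → Positive q → Positive (divℚ x q)
  divℚ-pos x (mkℚ +[1+ _ ] _ _) x>0 _ = ℚP.pos*pos⇒pos x {{x>0}} _

  divℚ-neg : ∀ x q → Negative x → Positive q → Negative (divℚ x q)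
  divℚ-neg x (mkℚ +[1+ _ ] _ _) x<0 _ = ℚP.neg*pos⇒neg x {{x<0}} _

  ratio-pos : ∀ a Q → 0 ℕ.< Q → Positive (divℚ (+[1+ a ] ℚ./ 1) (+ Q ℚ./ 1))
  ratio-pos a Q@(suc _) _ =
    divℚ-pos (+[1+ a ] ℚ./ 1) (+ Q ℚ./ 1) (ℚP.normalize-pos (suc a) 1) (ℚP.normalize-pos Q 1)

  ratio-neg : ∀ a Q → 0 ℕ.< Q → Negative (divℚ (-[1+ a ] ℚ./ 1) (+ Q ℚ./ 1))
  ratio-neg a Q@(suc _) _ =
    divℚ-neg (-[1+ a ] ℚ./ 1) (+ Q ℚ./ 1)
      (ℚP.neg-pos {ℚ.normalize (suc a) 1} (ℚP.normalize-pos (suc a) 1)) (ℚP.normalize-pos Q 1)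

  b+[a-b]≡a : ∀ a b → b ℚ.+ (a - b) ≡ a
  b+[a-b]≡a a b = begin
    b ℚ.+ (a - b)         ≡⟨ cong (b ℚ.+_) (ℚP.+-comm a (ℚ.- b)) ⟩
    b ℚ.+ (ℚ.- b ℚ.+ a)   ≡⟨ sym (ℚP.+-assoc b (ℚ.- b) a) ⟩
    (b ℚ.+ ℚ.- b) ℚ.+ a   ≡⟨ cong (ℚ._+ a) (ℚP.+-inverseʳ b) ⟩
    0ℚ ℚ.+ a              ≡⟨ ℚP.+-identityˡ a ⟩
    a                     ∎
    where open ≡-Reasoning

  diff-pos⇒< : ∀ a b → Positive (a - b) → b < a
  diff-pos⇒< a b a-b>0 = subst₂ _<_ (ℚP.+-identityʳ b) (b+[a-b]≡a a b)
    (ℚP.+-monoʳ-< b (ℚP.positive⁻¹ (a - b) {{a-b>0}}))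

  diff-neg⇒< : ∀ a b → Negative (a - b) → a < b
  diff-neg⇒< a b a-b<0 = subst₂ _<_ (b+[a-b]≡a a b) (ℚP.+-identityʳ b)
    (ℚP.+-monoʳ-< b (ℚP.negative⁻¹ (a - b) {{a-b<0}}))

module Coefficients where

  open IntegerForms
  open import Data.Nat using (suc; _≤_; _<_)
  open import Data.Integer as ℤ using (+_; -[1+_]; +[1+_]; ∣_∣)
  open import Relation.Binary.PropositionalEquality using (trans; cong)

  vℚ-Cseq : ∀ P Q n p → Prime p → 6 ≤ Q → 0 < P → Data.Nat.GCD.gcd P Q ≡ 1 →
            + p ≡ + Q ℤ.* + suc n ℤ.+ + P → vℚ p (Cseq (+ P) (+ Q) (suc n)) ≡ -[1+ 0 ]
  vℚ-Cseq P Q n p p-prime 6≤Q 0<P coprime p≡ =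
    vℚ-coefficient
      (λ j → + 12 ℤ.* + Q ℤ.* + j ℤ.+ + Q ℤ.+ + 6 ℤ.* + P)
      (λ j → + 12 ℤ.* + Q ℤ.* + j ℤ.+ + 5 ℤ.* + Q ℤ.+ + 6 ℤ.* + P)
      (λ j → + Q ℤ.* + j ℤ.+ + Q ℤ.+ + P)
      (∣A∣ Q P) (∣B∣ Q P) (∣D∣ Q P)
    where open Arithmetic P Q n p p-prime 6≤Q 0<P coprime (+-linear p Q (suc n) P p≡)

  vℚ-C'seq : ∀ a Q n p → Prime p → 6 ≤ Q → Data.Nat.GCD.gcd (suc a) Q ≡ 1 →
             + p ≡ + Q ℤ.* + suc n ℤ.+ +[1+ a ] → vℚ p (C'seq -[1+ a ] (+ Q) (suc n)) ≡ -[1+ 0 ]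
  vℚ-C'seq a Q n p p-prime 6≤Q coprime p≡ =
    vℚ-coefficient
      (λ j → + 12 ℤ.* + Q ℤ.* + j ℤ.+ + Q ℤ.- + 6 ℤ.* -[1+ a ])
      (λ j → + 12 ℤ.* + Q ℤ.* + j ℤ.+ + 5 ℤ.* + Q ℤ.- + 6 ℤ.* -[1+ a ])
      (λ j → + Q ℤ.* + j ℤ.+ + Q ℤ.- -[1+ a ])
      (λ j → trans (cong ∣_∣ (sub-6*neg (+ 12 ℤ.* + Q ℤ.* + j ℤ.+ + Q) +[1+ a ])) (∣A∣ Q (suc a) j))
      (λ j → trans (cong ∣_∣ (sub-6*neg (+ 12 ℤ.* + Q ℤ.* + j ℤ.+ + 5 ℤ.* + Q) +[1+ a ])) (∣B∣ Q (suc a) j))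
      (∣D∣ Q (suc a))
    where open Arithmetic (suc a) Q n p p-prime 6≤Q (Data.Nat.s≤s Data.Nat.z≤n) coprime
                          (+-linear p Q (suc n) (suc a) p≡)

open Sign using (ratio-pos; ratio-neg; diff-pos⇒<; diff-neg⇒<)
open Coefficients using (vℚ-Cseq; vℚ-C'seq)
open import Data.Integer as ℤ using (ℤ; +_; -[1+_])
import Data.Nat.Properties as ℕP
import Data.Integer.Properties as ℤP
open import Data.Integer.GCD using (gcd)
open import Data.Rational as ℚ using (ℚ; _-_; _<_; Positive; Negative)
open import Data.Product using (_×_; _,_)
open import Data.Sum using (_⊎_; inj₁; inj₂)
open import Data.Empty using (⊥-elim)
open import Relation.Binary.PropositionalEquality using (sym; trans; subst)

lemma2 : (m₁ m₂ : ℚ) (P Q : ℤ) →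
  m₁ - m₂ ≡ divℚ (ℚ._/_ P 1) (ℚ._/_ Q 1) →
  gcd P Q ≡ + 1 →
  + 6 ℤ.≤ Q →
  (m₂ < m₁ ×
    ((n p : ℕ) → 1 ℕ.≤ n → + p ≡ Q ℤ.* + n ℤ.+ P → Prime p →
      vℚ p (Cseq P Q n) ≡ -[1+ 0 ]))
  ⊎
  (m₁ < m₂ ×
    ((n p : ℕ) → 1 ℕ.≤ n → + p ≡ Q ℤ.* + n ℤ.- P → Prime p →
      vℚ p (C'seq P Q n) ≡ -[1+ 0 ]))
-- P = 0 is impossible: gcd(0, Q) = Q ≥ 6.
lemma2 m₁ m₂ (+ 0) (+ Q) _ gcd≡1 (ℤ.+≤+ 6≤Q) =
  ⊥-elim (ℕP.≤⇒≯ (subst (6 ℕ.≤_) Q≡1 6≤Q) (ℕ.s≤s (ℕ.s≤s ℕ.z≤n)))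
  where
  Q≡1 : Q ≡ 1
  Q≡1 = trans (sym (Data.Nat.GCD.gcd-identityˡ Q)) (ℤP.+-injective gcd≡1)
lemma2 m₁ m₂ ℤ.+[1+ a ] (+ Q) m₁-m₂≡P/Q gcd≡1 (ℤ.+≤+ 6≤Q) =
  inj₁ ( diff-pos⇒< m₁ m₂ (subst Positive (sym m₁-m₂≡P/Q) (ratio-pos a Q 0<Q))
       , λ { (ℕ.suc n) p _ p≡ p-prime →
               vℚ-Cseq (ℕ.suc a) Q n p p-prime 6≤Q (ℕ.s≤s ℕ.z≤n) (ℤP.+-injective gcd≡1) p≡ } )
  where
  0<Q : 0 ℕ.< Q
  0<Q = ℕP.<-≤-trans (ℕ.s≤s ℕ.z≤n) 6≤Q
lemma2 m₁ m₂ -[1+ a ] (+ Q) m₁-m₂≡P/Q gcd≡1 (ℤ.+≤+ 6≤Q) =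
  inj₂ ( diff-neg⇒< m₁ m₂ (subst Negative (sym m₁-m₂≡P/Q) (ratio-neg a Q 0<Q))
       , λ { (ℕ.suc n) p _ p≡ p-prime →
               vℚ-C'seq a Q n p p-prime 6≤Q (ℤP.+-injective gcd≡1) p≡ } )
  where
  0<Q : 0 ℕ.< Q
  0<Q = ℕP.<-≤-trans (ℕ.s≤s ℕ.z≤n) 6≤Q
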